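{- Let $M\ge p$, let $\lambda$ be a partition with $\ell(\lambda)=p$, regarded as $\lambda=(\lambda_1,\ldots,\lambda_M)$ with $\lambda_r=0$ for $r>p$, and let $I=(I_1,\ldots,I_M)$ be a weakly increasing integer sequence such that $I_k-I_{k-1}=1$ for some $k$ (with $2\le k\le M$). Write $d^J=\prod_{i=1}^M(1-t_i)^{J_i}$ for $J\in\mathbb{Z}^M$, and let $\epsilon_k$ be the $k$-th standard basis vector. Note that $I-\epsilon_k$ is also weakly increasing. (i) If $\lambda_{k-1}=\lambda_k$, then $t^\lambda d^I\ \overset{\mathcal S}{\sim}\ t^\lambda d^{I-\epsilon_k}$. (ii) If $\lambda_{k-1}>\lambda_k$, then $\lambda+\epsilon_k$ is a partition and \[ t^\lambda d^I\ \overset{\mathcal S}{\sim}\ t^\lambda d^{I-\epsilon_k}-t^{\lambda+\epsilon_k}d^{I-\epsilon_k}. \]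
   Context: Let $\mathbf{x}=(x_1,x_2,\ldots)$, $\mathbf{y}=(y_1,y_2,\ldots)$ be alphabets and define $h_r$ by $\sum_{r\ge0}h_ru^r=\prod_{y\in\mathbf y}(1+yu)/\prod_{x\in\mathbf x}(1-xu)$, with $h_r=0$ for $r<0$. For any finite integer sequence $I=(I_1,\ldots,I_p)$ the (possibly fake) Schur function is $s_I=\det(h_{I_i+j-i})_{1\le i,j\le p}$. For an ordered alphabet $\mathbf{t}=(t_1,t_2,\ldots)$ and $I\in\mathbb{Z}^n$, $t^I=\prod_jt_j^{I_j}$; the operation $\mathcal S_{\mathbf t}$ is defined by $\mathcal S_{\mathbf t}(t^I)=s_I$, extended $\mathbb{Z}$-linearly (rational functions via Laurent expansion on the domain $|t_i|<|t_j|$ for $i<j$). $f_1\overset{\mathcal S}{\sim}f_2$ means $\mathcal S_{\mathbf t}(f_1)=\mathcal S_{\mathbf t}(f_2)$. -}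

module Defs where

open import Level using (Level)
open import Algebra.Bundles using (CommutativeRing)
open import Data.Nat as ℕ using (ℕ; zero; suc; _∸_)
open import Data.Integer as ℤ using (ℤ; +_; -[1+_])
open import Data.Fin using (Fin; zero; suc; toℕ; punchIn; _≟_)
open import Data.List using (List; []; _∷_; foldr; map; upTo; allFin; concat)
open import Data.Vec.Functional using (Vector) renaming (_∷_ to _∷ᵥ_)
open import Relation.Nullary using (yes; no)
open import Data.Product using (_×_)
open import Relation.Binary.PropositionalEquality using (_≡_)

Series : Set
Series = ℕ → ℤ

sumℤ : List ℤ → ℤ
sumℤ = foldr ℤ._+_ (+ 0)

conv : Series → Series → Series
conv f g n = sumℤ (map (λ i → f i ℤ.* g (n ∸ i)) (upTo (suc n)))

unitS : Series
unitS zero    = + 1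
unitS (suc _) = + 0

oneMinus : Series
oneMinus zero          = + 1
oneMinus (suc zero)    = ℤ.- (+ 1)
oneMinus (suc (suc _)) = + 0

geom : Series
geom _ = + 1

powS : ℕ → Series → Series
powS zero    s = unitS
powS (suc k) s = conv s (powS k s)

-- (1 - u)^a for a ∈ ℤ, expanded as a power series in u
dser : ℤ → Series
dser (+ b)    = powS b oneMinus
dser -[1+ b ] = powS (suc b) geom

-- coefficient of u^m (m ∈ ℤ) in (1 - u)^a ; zero for m < 0
coefZ : ℤ → ℤ → ℤ
coefZ a (+ m)    = dser a m
coefZ a -[1+ _ ] = + 0

comps : ℕ → (M : ℕ) → List (Vector ℕ M)
comps zero    zero    = (λ ()) ∷ []
comps (suc _) zero    = []
comps N       (suc M) =
  concat (map (λ i → map (λ E → i ∷ᵥ E) (comps (N ∸ i) M)) (upTo (suc N)))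

prodFin : (M : ℕ) → (Fin M → ℤ) → ℤ
prodFin zero    f = + 1
prodFin (suc M) f = f zero ℤ.* prodFin M (λ i → f (suc i))

addε : {M : ℕ} → (Fin M → ℕ) → Fin M → (Fin M → ℕ)
addε λ' k i with i ≟ k
... | yes _ = suc (λ' i)
... | no  _ = λ' i

subε : {M : ℕ} → (Fin M → ℤ) → Fin M → (Fin M → ℤ)
subε J k i with i ≟ k
... | yes _ = J i ℤ.- + 1
... | no  _ = J i

module _ {c ℓ : Level} (R : CommutativeRing c ℓ) where
  open CommutativeRing R using (Carrier; _+_; _*_; -_; 0#; 1#)

  sumR : List Carrier → Carrier
  sumR = foldr _+_ 0#

  fromℕR : ℕ → Carrier
  fromℕR zero    = 0#
  fromℕR (suc n) = 1# + fromℕR n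

  fromℤR : ℤ → Carrier
  fromℤR (+ n)    = fromℕR n
  fromℤR -[1+ n ] = - (1# + fromℕR n)

  signR : ℕ → Carrier → Carrier
  signR zero    x = x
  signR (suc k) x = - signR k x

  det : (n : ℕ) → (Fin n → Fin n → Carrier) → Carrier
  det zero    A = 1#
  det (suc n) A =
    sumR (map (λ j → signR (toℕ j) (A zero j * det n (λ r c' → A (suc r) (punchIn j c'))))
              (allFin (suc n)))

  hZ : (ℕ → Carrier) → ℤ → Carrier
  hZ h (+ n)    = h n
  hZ h -[1+ _ ] = 0#

  -- (possibly fake) Schur function s_J = det (h_{J_i + j - i})
  schur : (ℕ → Carrier) → {M : ℕ} → (Fin M → ℤ) → Carrier
  schur h {M} J = det M (λ i j → hZ h ((J i ℤ.+ + toℕ j) ℤ.- + toℕ i))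

  -- Degree-N component of  S_t ( t^λ d^J ),  where d^J = ∏ (1 - t_i)^{J_i}:
  --   Σ_{E ∈ ℕ^M, |E| = N} [t^E](t^λ d^J) · s_E
  Sdeg : (ℕ → Carrier) → {M : ℕ} → ℕ → (Fin M → ℕ) → (Fin M → ℤ) → Carrier
  Sdeg h {M} N λ' J =
    sumR (map (λ E → fromℤR (prodFin M (λ i → coefZ (J i) (+ E i ℤ.- + λ' i))) * schur h (λ i → + E i))
              (comps N M))

WeaklyDecreasing : {M : ℕ} → (Fin M → ℕ) → Set
WeaklyDecreasing {M} λ' = ∀ (i j : Fin M) → toℕ i ℕ.≤ toℕ j → λ' j ℕ.≤ λ' i

WeaklyIncreasingℤ : {M : ℕ} → (Fin M → ℤ) → Set
WeaklyIncreasingℤ {M} I = ∀ (i j : Fin M) → toℕ i ℕ.≤ toℕ j → I i ℤ.≤ I j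

IsPartitionOfLength : {M : ℕ} → ℕ → (Fin M → ℕ) → Set
IsPartitionOfLength {M} p λ' =
  WeaklyDecreasing λ'
  × (∀ (i : Fin M) → toℕ i ℕ.< p → 0 ℕ.< λ' i)
  × (∀ (i : Fin M) → p ℕ.≤ toℕ i → λ' i ≡ 0)

-- Since d^I = d^(I-ε_k) · (1 - t_k), comparing coefficients gives
-- t^λ d^I ~ t^λ d^(I-ε_k) - t^(λ+ε_k) d^(I-ε_k) for every k, which is (ii).
-- For (i) it remains to see that S(t^μ d^J) = 0 for μ = λ + ε_k and J = I - ε_k,
-- which satisfy μ_k = μ_(k-1) + 1 and J_k = J_(k-1). Write S(t^μ d^J) = Σ_E [t^E](t^μ d^J) s_E.
-- The dot action E ↦ (…, E_k - 1, E_(k-1) + 1, …) of the transposition (k-1 k) exchanges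
-- two adjacent rows of the Jacobi–Trudi determinant s_E, so it negates s_E, and s_E = 0 at
-- its fixed points E_k = E_(k-1) + 1. The coefficient [t^E](t^μ d^J) is invariant under it,
-- because J_k = J_(k-1) and μ_k = μ_(k-1) + 1, and vanishes when E_k = 0 < μ_k.
-- So the terms of S(t^μ d^J) cancel in pairs.

module Submission where

open import Defs
open import Algebra.Bundles using (CommutativeRing)
open import Data.Nat as ℕ using (ℕ; zero; suc; _≤_; _<_; _∸_; s≤s)
import Algebra.Properties.Ring
import Algebra.Properties.CommutativeSemigroup
import Data.Nat.Properties as ℕₚ
open import Data.Integer as ℤ using (ℤ; +_; -[1+_]; _⊖_)
import Data.Integer.Properties as ℤₚ
open import Data.Integer.Tactic.RingSolver using (solve-∀)
open import Data.Fin using (Fin; zero; suc; toℕ; punchIn; punchOut; _≟_)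
import Data.Fin.Properties as Finₚ
open import Data.List using (List; []; _∷_; map; concat; tabulate; applyUpTo; upTo; _++_)
import Data.List.Properties as Listₚ
open import Data.Vec.Functional using (Vector) renaming (_∷_ to _∷ᵥ_)
open import Data.Product using (_×_; _,_)
open import Data.Sum as Sum using (_⊎_; inj₁; inj₂)
open import Data.Empty using (⊥-elim)
open import Function using (_∘_)
open import Relation.Binary.Core using (Rel)
open import Relation.Nullary using (yes; no)
open import Relation.Binary.PropositionalEquality as ≡ using (_≡_; _≢_; refl)

[1+m]-[1+n]≡m-n : ∀ m n → + suc m ℤ.- + suc n ≡ + m ℤ.- + n
[1+m]-[1+n]≡m-n m n = ≡.trans (ℤₚ.[1+m]⊖[1+n]≡m⊖n m n) (≡.sym (ℤₚ.m-n≡m⊖n m n))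

m∸n≡1+m∸[1+n] : ∀ {m n} → n < m → m ∸ n ≡ suc (m ∸ suc n)
m∸n≡1+m∸[1+n] n<m = ℕₚ.+-∸-assoc 1 n<m

[m∸n]∸[1+o]≡[m∸o]∸[1+n] : ∀ m n o → m ∸ n ∸ suc o ≡ m ∸ o ∸ suc n
[m∸n]∸[1+o]≡[m∸o]∸[1+n] m n o = begin
  m ∸ n ∸ suc o      ≡⟨ ℕₚ.∸-+-assoc m n (suc o) ⟩
  m ∸ (n ℕ.+ suc o)  ≡⟨ ≡.cong (m ∸_) (≡.trans (ℕₚ.+-comm n (suc o)) (≡.sym (ℕₚ.+-suc o n))) ⟩
  m ∸ (o ℕ.+ suc n)  ≡⟨ ℕₚ.∸-+-assoc m o (suc n) ⟨
  m ∸ o ∸ suc n      ∎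
  where open ≡.≡-Reasoning

data Adjacent : ∀ {n} → Fin n → Fin n → Set where
  here  : ∀ {n} → Adjacent {suc (suc n)} zero (suc zero)
  there : ∀ {n} {i j : Fin n} → Adjacent i j → Adjacent (suc i) (suc j)

toℕ-adjacent : ∀ {n} {i j : Fin n} → toℕ j ≡ suc (toℕ i) → Adjacent i j
toℕ-adjacent {i = zero}  {zero}        ()
toℕ-adjacent {i = zero}  {suc zero}    refl = here
toℕ-adjacent {i = zero}  {suc (suc j)} ()
toℕ-adjacent {i = suc i} {suc j}       e    = there (toℕ-adjacent (ℕₚ.suc-injective e))

adjacent⇒≢ : ∀ {n} {i j : Fin n} → Adjacent i j → i ≢ j
adjacent⇒≢ here      ()
adjacent⇒≢ (there a) refl = adjacent⇒≢ a refl

adjacent⇒toℕ : ∀ {n} {i j : Fin n} → Adjacent i j → toℕ j ≡ suc (toℕ i)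
adjacent⇒toℕ here      = refl
adjacent⇒toℕ (there a) = ≡.cong suc (adjacent⇒toℕ a)

Transposed : ∀ {a r} {A : Set a} → Rel A r → ∀ {n} → Fin n → Fin n → (Fin n → A) → (Fin n → A) → Set r
Transposed _∼_ k₀ k f g = g k₀ ∼ f k × g k ∼ f k₀ × (∀ i → i ≢ k₀ → i ≢ k → g i ∼ f i)

transposed-suc : ∀ {a r} {A : Set a} {_∼_ : Rel A r} {n} {k₀ k : Fin n} {f g : Fin (suc n) → A} →
  Transposed _∼_ (suc k₀) (suc k) f g → Transposed _∼_ k₀ k (f ∘ suc) (g ∘ suc)
transposed-suc (e₀ , e , rest) = e₀ , e , λ i i≢k₀ i≢k → rest (suc i) (i≢k₀ ∘ Finₚ.suc-injective) (i≢k ∘ Finₚ.suc-injective)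

punchIn-punchOut-comm : ∀ {n} (a b : Fin (suc (suc n))) (a≢b : a ≢ b) (b≢a : b ≢ a) (c : Fin n) →
  punchIn a (punchIn (punchOut a≢b) c) ≡ punchIn b (punchIn (punchOut b≢a) c)
punchIn-punchOut-comm zero    zero    a≢b _ c = ⊥-elim (a≢b refl)
punchIn-punchOut-comm zero    (suc b) _   _ c = refl
punchIn-punchOut-comm (suc a) zero    _   _ c = refl
punchIn-punchOut-comm {suc n} (suc a) (suc b) _ _ zero = refl
punchIn-punchOut-comm {suc n} (suc a) (suc b) a≢b b≢a (suc c) =
  ≡.cong suc (punchIn-punchOut-comm a b (a≢b ∘ ≡.cong suc) (b≢a ∘ ≡.cong suc) c)

-- The sign exponents of the two orders of deleting columns a and b differ by one.
punchOut-parity : ∀ {n} (a b : Fin (suc (suc n))) (a≢b : a ≢ b) (b≢a : b ≢ a) →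
  let m = toℕ a ℕ.+ toℕ (punchOut a≢b); m′ = toℕ b ℕ.+ toℕ (punchOut b≢a) in
  m′ ≡ suc m ⊎ m ≡ suc m′
punchOut-parity zero    zero    a≢b _ = ⊥-elim (a≢b refl)
punchOut-parity zero    (suc b) _   _ = inj₁ (≡.cong suc (ℕₚ.+-identityʳ _))
punchOut-parity (suc a) zero    _   _ = inj₂ (≡.cong suc (ℕₚ.+-identityʳ _))
punchOut-parity {zero}  (suc zero) (suc zero) a≢b _ = ⊥-elim (a≢b refl)
punchOut-parity {suc n} (suc a) (suc b) a≢b b≢a =
  Sum.map shift shift (punchOut-parity a b (a≢b ∘ ≡.cong suc) (b≢a ∘ ≡.cong suc))
  where
  shift : ∀ {x y z w} → y ℕ.+ w ≡ suc (x ℕ.+ z) → suc y ℕ.+ suc w ≡ suc (suc x ℕ.+ suc z)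
  shift {x} {y} {z} {w} e =
    ≡.cong suc (≡.trans (ℕₚ.+-suc y w) (≡.cong suc (≡.trans e (≡.sym (ℕₚ.+-suc x z)))))

addε-updates : ∀ {M} (μ : Fin M → ℕ) k → addε μ k k ≡ suc (μ k)
addε-updates μ k with k ≟ k
... | yes _   = refl
... | no k≢k = ⊥-elim (k≢k refl)

addε-minimal : ∀ {M} (μ : Fin M → ℕ) {k i} → i ≢ k → addε μ k i ≡ μ i
addε-minimal μ {k} {i} i≢k with i ≟ k
... | yes i≡k = ⊥-elim (i≢k i≡k)
... | no _    = refl

subε-updates : ∀ {M} (J : Fin M → ℤ) k → subε J k k ≡ J k ℤ.- + 1
subε-updates J k with k ≟ k
... | yes _   = refl
... | no k≢k = ⊥-elim (k≢k refl)

subε-minimal : ∀ {M} (J : Fin M → ℤ) {k i} → i ≢ k → subε J k i ≡ J i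
subε-minimal J {k} {i} i≢k with i ≟ k
... | yes i≡k = ⊥-elim (i≢k i≡k)
... | no _    = refl

addε-weaklyDecreasing : ∀ {M} {μ : Fin M → ℕ} {k₀ k : Fin M} → WeaklyDecreasing μ →
  toℕ k ≡ suc (toℕ k₀) → μ k < μ k₀ → WeaklyDecreasing (addε μ k)
addε-weaklyDecreasing {μ = μ} {k₀} {k} dec k≡1+k₀ μk<μk₀ i j i≤j with i ≟ k | j ≟ k
... | yes refl | yes refl = s≤s (dec i j i≤j)
... | yes refl | no _     = ℕₚ.m≤n⇒m≤1+n (dec i j i≤j)
... | no i≢k   | yes refl = ℕₚ.≤-trans μk<μk₀ (dec i k₀ i≤k₀)
  where
  i≤k₀ : toℕ i ≤ toℕ k₀
  i≤k₀ = ℕₚ.≤-pred (≡.subst (toℕ i <_) k≡1+k₀ (ℕₚ.≤∧≢⇒< i≤j (i≢k ∘ Finₚ.toℕ-injective)))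
... | no _     | no _     = dec i j i≤j

module ℤRing = Algebra.Properties.Ring ℤₚ.+-*-ring

prodFin-cong : ∀ M {f g : Fin M → ℤ} → (∀ i → f i ≡ g i) → prodFin M f ≡ prodFin M g
prodFin-cong zero    f≗g = refl
prodFin-cong (suc M) f≗g = ≡.cong₂ ℤ._*_ (f≗g zero) (prodFin-cong M (f≗g ∘ suc))

prodFin-linear : ∀ M (f g h : Fin M → ℤ) k → f k ≡ g k ℤ.- h k →
  (∀ i → i ≢ k → f i ≡ g i) → (∀ i → i ≢ k → f i ≡ h i) →
  prodFin M f ≡ prodFin M g ℤ.- prodFin M h
prodFin-linear (suc M) f g h zero fk f≗g f≗h = begin
  f zero ℤ.* P f                          ≡⟨ ≡.cong (ℤ._* P f) fk ⟩
  (g zero ℤ.- h zero) ℤ.* P f             ≡⟨ ℤRing.[y-z]x≈yx-zx (P f) (g zero) (h zero) ⟩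
  g zero ℤ.* P f ℤ.- h zero ℤ.* P f       ≡⟨ ≡.cong₂ (λ x y → g zero ℤ.* x ℤ.- h zero ℤ.* y)
                                               (prodFin-cong M (λ i → f≗g (suc i) λ ()))
                                               (prodFin-cong M (λ i → f≗h (suc i) λ ())) ⟩
  g zero ℤ.* P g ℤ.- h zero ℤ.* P h       ∎
  where
  open ≡.≡-Reasoning
  P : (Fin (suc M) → ℤ) → ℤ
  P u = prodFin M (u ∘ suc)
prodFin-linear (suc M) f g h (suc k) fk f≗g f≗h = begin
  f zero ℤ.* prodFin M (f ∘ suc)
    ≡⟨ ≡.cong (f zero ℤ.*_) (prodFin-linear M (f ∘ suc) (g ∘ suc) (h ∘ suc) k fk
         (λ i i≢k → f≗g (suc i) (i≢k ∘ Finₚ.suc-injective))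
         (λ i i≢k → f≗h (suc i) (i≢k ∘ Finₚ.suc-injective))) ⟩
  f zero ℤ.* (prodFin M (g ∘ suc) ℤ.- prodFin M (h ∘ suc))
    ≡⟨ ℤRing.x[y-z]≈xy-xz (f zero) _ _ ⟩
  f zero ℤ.* prodFin M (g ∘ suc) ℤ.- f zero ℤ.* prodFin M (h ∘ suc)
    ≡⟨ ≡.cong₂ (λ x y → x ℤ.* prodFin M (g ∘ suc) ℤ.- y ℤ.* prodFin M (h ∘ suc)) (f≗g zero λ ()) (f≗h zero λ ()) ⟩
  g zero ℤ.* prodFin M (g ∘ suc) ℤ.- h zero ℤ.* prodFin M (h ∘ suc) ∎
  where open ≡.≡-Reasoning

prodFin-zero : ∀ M (f : Fin M → ℤ) k → f k ≡ + 0 → prodFin M f ≡ + 0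
prodFin-zero (suc M) f zero    fk≡0 = ≡.cong (ℤ._* prodFin M (f ∘ suc)) fk≡0
prodFin-zero (suc M) f (suc k) fk≡0 =
  ≡.trans (≡.cong (f zero ℤ.*_) (prodFin-zero M (f ∘ suc) k fk≡0)) (ℤₚ.*-zeroʳ (f zero))

prodFin-transpose : ∀ {M} {k₀ k : Fin M} {f g : Fin M → ℤ} →
  Adjacent k₀ k → Transposed _≡_ k₀ k f g → prodFin M f ≡ prodFin M g
prodFin-transpose {suc (suc M)} {f = f} {g} here (g0≡f1 , g1≡f0 , rest) = begin
  f zero ℤ.* (f (suc zero) ℤ.* P f)   ≡⟨ ℤCS.x∙yz≈y∙xz (f zero) (f (suc zero)) (P f) ⟩
  f (suc zero) ℤ.* (f zero ℤ.* P f)   ≡⟨ ≡.cong₂ (λ x y → x ℤ.* (y ℤ.* P f)) (≡.sym g0≡f1) (≡.sym g1≡f0) ⟩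
  g zero ℤ.* (g (suc zero) ℤ.* P f)   ≡⟨ ≡.cong (λ x → g zero ℤ.* (g (suc zero) ℤ.* x))
                                           (prodFin-cong M (λ i → ≡.sym (rest (suc (suc i)) (λ ()) (λ ())))) ⟩
  g zero ℤ.* (g (suc zero) ℤ.* P g)   ∎
  where
  open ≡.≡-Reasoning
  module ℤCS = Algebra.Properties.CommutativeSemigroup ℤₚ.*-commutativeSemigroup
  P : (Fin (suc (suc M)) → ℤ) → ℤ
  P u = prodFin M (λ i → u (suc (suc i)))
prodFin-transpose {suc M} {f = f} (there adj) t@(_ , _ , rest) =
  ≡.cong₂ ℤ._*_ (≡.sym (rest zero (λ ()) (λ ()))) (prodFin-transpose adj (transposed-suc {_∼_ = _≡_} t))

-- The series (1 - u)^a

conv-zero : ∀ f s → conv f s 0 ≡ f 0 ℤ.* s 0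
conv-zero f s = ℤₚ.+-identityʳ (f 0 ℤ.* s 0)

conv-suc : ∀ f s n → conv f s (suc n) ≡ f 0 ℤ.* s (suc n) ℤ.+ conv (f ∘ suc) s n
conv-suc f s n = ≡.cong (ℤ._+_ (f 0 ℤ.* s (suc n))) (≡.cong sumℤ (≡.trans
  (Listₚ.map-applyUpTo suc (λ i → f i ℤ.* s (suc n ∸ i)) (suc n))
  (≡.sym (Listₚ.map-applyUpTo (λ i → i) (λ i → f (suc i) ℤ.* s (n ∸ i)) (suc n)))))

conv-zeroˡ : ∀ s n → conv (λ _ → + 0) s n ≡ + 0
conv-zeroˡ s n = sum-zeros (upTo (suc n))
  where
  sum-zeros : (xs : List ℕ) → sumℤ (map (λ _ → + 0) xs) ≡ + 0
  sum-zeros []       = refl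
  sum-zeros (_ ∷ xs) = ≡.cong (ℤ._+_ (+ 0)) (sum-zeros xs)

conv-oneMinus-zero : ∀ s → conv oneMinus s 0 ≡ s 0
conv-oneMinus-zero s = ≡.trans (conv-zero oneMinus s) (ℤₚ.*-identityˡ (s 0))

conv-oneMinus : ∀ s n → conv oneMinus s (suc n) ≡ s (suc n) ℤ.- s n
conv-oneMinus s n = begin
  conv oneMinus s (suc n)                         ≡⟨ conv-suc oneMinus s n ⟩
  + 1 ℤ.* s (suc n) ℤ.+ conv (oneMinus ∘ suc) s n ≡⟨ ≡.cong₂ ℤ._+_ (ℤₚ.*-identityˡ (s (suc n))) (conv-tail n) ⟩
  s (suc n) ℤ.+ -[1+ 0 ] ℤ.* s n                  ≡⟨ ≡.cong (ℤ._+_ (s (suc n))) (ℤₚ.-1*i≡-i (s n)) ⟩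
  s (suc n) ℤ.- s n                               ∎
  where
  open ≡.≡-Reasoning
  conv-tail : ∀ n → conv (oneMinus ∘ suc) s n ≡ -[1+ 0 ] ℤ.* s n
  conv-tail zero    = conv-zero (oneMinus ∘ suc) s
  conv-tail (suc n) = ≡.trans (conv-suc (oneMinus ∘ suc) s n)
    (≡.trans (≡.cong (ℤ._+_ (-[1+ 0 ] ℤ.* s (suc n))) (conv-zeroˡ s n)) (ℤₚ.+-identityʳ _))

conv-geom-zero : ∀ s → conv geom s 0 ≡ s 0
conv-geom-zero s = ≡.trans (conv-zero geom s) (ℤₚ.*-identityˡ (s 0))

conv-geom : ∀ s n → conv geom s (suc n) ≡ s (suc n) ℤ.+ conv geom s n
conv-geom s n = ≡.trans (conv-suc geom s n) (≡.cong (ℤ._+ conv geom s n) (ℤₚ.*-identityˡ (s (suc n))))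

conv-geom-difference : ∀ t n → t (suc n) ≡ conv geom t (suc n) ℤ.- conv geom t n
conv-geom-difference t n = ≡.trans (x≡[x+y]-y (t (suc n)) (conv geom t n))
  (≡.cong (ℤ._- conv geom t n) (≡.sym (conv-geom t n)))
  where
  x≡[x+y]-y : ∀ x y → x ≡ (x ℤ.+ y) ℤ.- y
  x≡[x+y]-y = solve-∀

-- (1 - u)^(a+1) = (1 - u) · (1 - u)^a; for negative a this is (1 - u)^a = geom · (1 - u)^(a+1).
dser-suc-zero : ∀ a → dser (a ℤ.+ + 1) 0 ≡ dser a 0
dser-suc-zero (+ b) rewrite ℕₚ.+-comm b 1 = conv-oneMinus-zero (dser (+ b))
dser-suc-zero -[1+ zero ]  = ≡.sym (conv-geom-zero unitS)
dser-suc-zero -[1+ suc b ] = ≡.sym (conv-geom-zero (powS (suc b) geom))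

dser-suc : ∀ a n → dser (a ℤ.+ + 1) (suc n) ≡ dser a (suc n) ℤ.- dser a n
dser-suc (+ b) n rewrite ℕₚ.+-comm b 1 = conv-oneMinus (dser (+ b)) n
dser-suc -[1+ zero ]  n = conv-geom-difference unitS n
dser-suc -[1+ suc b ] n = conv-geom-difference (powS (suc b) geom) n

coefZ-suc : ∀ a m → coefZ (a ℤ.+ + 1) m ≡ coefZ a m ℤ.- coefZ a (m ℤ.- + 1)
coefZ-suc a (+ zero)  = ≡.trans (dser-suc-zero a) (≡.sym (ℤₚ.+-identityʳ _))
coefZ-suc a (+ suc n) = dser-suc a n
coefZ-suc a -[1+ n ]  = refl

coefZ-pred : ∀ a e l → coefZ a (+ e ℤ.- + l) ≡ coefZ (a ℤ.- + 1) (+ e ℤ.- + l) ℤ.- coefZ (a ℤ.- + 1) (+ e ℤ.- + suc l)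
coefZ-pred a e l = begin
  coefZ a (+ e ℤ.- + l)                                    ≡⟨ ≡.cong (λ b → coefZ b (+ e ℤ.- + l)) (x≡[x-1]+1 a) ⟩
  coefZ ((a ℤ.- + 1) ℤ.+ + 1) (+ e ℤ.- + l)                ≡⟨ coefZ-suc (a ℤ.- + 1) (+ e ℤ.- + l) ⟩
  coefZ (a ℤ.- + 1) (+ e ℤ.- + l) ℤ.- coefZ (a ℤ.- + 1) ((+ e ℤ.- + l) ℤ.- + 1)
    ≡⟨ ≡.cong (λ x → coefZ (a ℤ.- + 1) (+ e ℤ.- + l) ℤ.- coefZ (a ℤ.- + 1) x) ([x-y]-1≡x-[1+y] (+ e) (+ l)) ⟩
  coefZ (a ℤ.- + 1) (+ e ℤ.- + l) ℤ.- coefZ (a ℤ.- + 1) (+ e ℤ.- + suc l) ∎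
  where
  open ≡.≡-Reasoning
  x≡[x-1]+1 : ∀ x → x ≡ (x ℤ.- + 1) ℤ.+ + 1
  x≡[x-1]+1 = solve-∀
  [x-y]-1≡x-[1+y] : ∀ x y → (x ℤ.- y) ℤ.- + 1 ≡ x ℤ.- (+ 1 ℤ.+ y)
  [x-y]-1≡x-[1+y] = solve-∀

coefZ-below : ∀ a {m n} → m < n → coefZ a (+ m ℤ.- + n) ≡ + 0
coefZ-below a {zero}  {suc n} _         = refl
coefZ-below a {suc m} {suc n} (s≤s m<n) =
  ≡.trans (≡.cong (coefZ a) ([1+m]-[1+n]≡m-n m n)) (coefZ-below a m<n)

coeff : ∀ {M} → (Fin M → ℕ) → (Fin M → ℤ) → (Fin M → ℕ) → ℤ
coeff {M} μ J E = prodFin M (λ i → coefZ (J i) (+ E i ℤ.- + μ i))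

coeff-split : ∀ {M} (μ : Fin M → ℕ) J k E →
  coeff μ J E ≡ coeff μ (subε J k) E ℤ.- coeff (addε μ k) (subε J k) E
coeff-split {M} μ J k E = prodFin-linear M _ _ _ k at-k
  (λ i i≢k → ≡.cong (λ a → coefZ a (+ E i ℤ.- + μ i)) (≡.sym (subε-minimal J i≢k)))
  (λ i i≢k → ≡.cong₂ (λ a b → coefZ a (+ E i ℤ.- + b)) (≡.sym (subε-minimal J i≢k)) (≡.sym (addε-minimal μ i≢k)))
  where
  at-k : coefZ (J k) (+ E k ℤ.- + μ k)
       ≡ coefZ (subε J k k) (+ E k ℤ.- + μ k) ℤ.- coefZ (subε J k k) (+ E k ℤ.- + addε μ k k)
  at-k rewrite subε-updates J k | addε-updates μ k = coefZ-pred (J k) (E k) (μ k)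

coeff-below : ∀ {M} (μ : Fin M → ℕ) J E k → E k < μ k → coeff μ J E ≡ + 0
coeff-below {M} μ J E k Ek<μk = prodFin-zero M _ k (coefZ-below (J k) Ek<μk)

DotTransposed : ∀ {M} → Fin M → Fin M → (Fin M → ℕ) → (Fin M → ℕ) → Set
DotTransposed k₀ k E E′ = E k ≡ suc (E′ k₀) × E′ k ≡ suc (E k₀) × (∀ i → i ≢ k₀ → i ≢ k → E′ i ≡ E i)

dotTransposed-cons : ∀ {M} {k₀ k : Fin M} {E E′} i → DotTransposed k₀ k E E′ →
  DotTransposed (suc k₀) (suc k) (i ∷ᵥ E) (i ∷ᵥ E′)
dotTransposed-cons i (Ek≡1+E′k₀ , E′k≡1+Ek₀ , rest) = Ek≡1+E′k₀ , E′k≡1+Ek₀ , λ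
  { zero    _      _     → refl
  ; (suc r) r≢k₀ r≢k → rest r (r≢k₀ ∘ ≡.cong suc) (r≢k ∘ ≡.cong suc)
  }

coeff-dotTransposed : ∀ {M} {μ : Fin M → ℕ} {J : Fin M → ℤ} {k₀ k E E′} → Adjacent k₀ k →
  J k₀ ≡ J k → μ k ≡ suc (μ k₀) → DotTransposed k₀ k E E′ → coeff μ J E ≡ coeff μ J E′
coeff-dotTransposed {μ = μ} {J} {k₀} {k} {E} {E′} adj Jk₀≡Jk μk≡1+μk₀ (Ek≡1+E′k₀ , E′k≡1+Ek₀ , rest) =
  prodFin-transpose adj (at-k₀ , at-k , λ i i≢k₀ i≢k → ≡.cong (λ e → coefZ (J i) (+ e ℤ.- + μ i)) (rest i i≢k₀ i≢k))
  where
  at-k₀ : coefZ (J k₀) (+ E′ k₀ ℤ.- + μ k₀) ≡ coefZ (J k) (+ E k ℤ.- + μ k)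
  at-k₀ rewrite Ek≡1+E′k₀ | μk≡1+μk₀ = ≡.cong₂ coefZ Jk₀≡Jk (≡.sym ([1+m]-[1+n]≡m-n (E′ k₀) (μ k₀)))
  at-k : coefZ (J k) (+ E′ k ℤ.- + μ k) ≡ coefZ (J k₀) (+ E k₀ ℤ.- + μ k₀)
  at-k rewrite E′k≡1+Ek₀ | μk≡1+μk₀ = ≡.cong₂ coefZ (≡.sym Jk₀≡Jk) ([1+m]-[1+n]≡m-n (E k₀) (μ k₀))

comps-suc : ∀ N M → comps N (suc M) ≡ concat (map (λ i → map (i ∷ᵥ_) (comps (N ∸ i) M)) (upTo (suc N)))
comps-suc zero    M = refl
comps-suc (suc N) M = refl

module _ {c ℓ} (R : CommutativeRing c ℓ) where
  open CommutativeRing R hiding (zero) renaming (refl to ≈-refl)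
  open import Algebra.Properties.Ring ring using (-0#≈0#; -‿+-comm; -‿involutive; -‿distribʳ-*; [y-z]x≈yx-zx)
  open import Algebra.Properties.Semiring.Sum semiring
    using (sum; sum-cong-≋; sum-replicate-zero; ∑-distrib-+; ∑-comm; sum-remove; *-distribˡ-sum)
  open import Algebra.Properties.CommutativeSemigroup +-commutativeSemigroup using (interchange)
  open import Data.Vec.Functional.Relation.Binary.Equality.Setoid setoid using (_≋_)
  open import Relation.Binary.Reasoning.Setoid setoid

  [x+y]-[x+z]≈y-z : ∀ x y z → (x + y) - (x + z) ≈ y - z
  [x+y]-[x+z]≈y-z x y z = begin
    (x + y) + - (x + z)    ≈⟨ +-congˡ (-‿+-comm x z) ⟨
    (x + y) + (- x + - z)  ≈⟨ interchange x y (- x) (- z) ⟩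
    (x - x) + (y - z)      ≈⟨ +-congʳ (-‿inverseʳ x) ⟩
    0# + (y - z)           ≈⟨ +-identityˡ (y - z) ⟩
    y - z                  ∎

  fromℕR-homo-+ : ∀ m n → fromℕR R (m ℕ.+ n) ≈ fromℕR R m + fromℕR R n
  fromℕR-homo-+ zero    n = sym (+-identityˡ _)
  fromℕR-homo-+ (suc m) n = trans (+-congˡ (fromℕR-homo-+ m n)) (sym (+-assoc _ _ _))

  fromℤR-⊖ : ∀ m n → fromℤR R (m ⊖ n) ≈ fromℕR R m - fromℕR R n
  fromℤR-⊖ zero    zero    = sym (-‿inverseʳ 0#)
  fromℤR-⊖ zero    (suc n) = sym (+-identityˡ _)
  fromℤR-⊖ (suc m) zero    = sym (trans (+-congˡ -0#≈0#) (+-identityʳ _))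
  fromℤR-⊖ (suc m) (suc n) = begin
    fromℤR R (suc m ⊖ suc n)               ≡⟨ ≡.cong (fromℤR R) (ℤₚ.[1+m]⊖[1+n]≡m⊖n m n) ⟩
    fromℤR R (m ⊖ n)                       ≈⟨ fromℤR-⊖ m n ⟩
    fromℕR R m - fromℕR R n                ≈⟨ [x+y]-[x+z]≈y-z 1# _ _ ⟨
    fromℕR R (suc m) - fromℕR R (suc n)    ∎

  fromℤR-homo-+ : ∀ x y → fromℤR R (x ℤ.+ y) ≈ fromℤR R x + fromℤR R y
  fromℤR-homo-+ (+ m)    (+ n)    = fromℕR-homo-+ m n
  fromℤR-homo-+ (+ m)    -[1+ n ] = fromℤR-⊖ m (suc n)
  fromℤR-homo-+ -[1+ m ] (+ n)    = trans (fromℤR-⊖ n (suc m)) (+-comm _ _)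
  fromℤR-homo-+ -[1+ m ] -[1+ n ] = begin
    - fromℕR R (suc (suc (m ℕ.+ n)))           ≡⟨ ≡.cong (λ k → - fromℕR R (suc k)) (ℕₚ.+-suc m n) ⟨
    - fromℕR R (suc m ℕ.+ suc n)               ≈⟨ -‿cong (fromℕR-homo-+ (suc m) (suc n)) ⟩
    - (fromℕR R (suc m) + fromℕR R (suc n))    ≈⟨ -‿+-comm _ _ ⟨
    - fromℕR R (suc m) + - fromℕR R (suc n)    ∎

  fromℤR-homo-neg : ∀ x → fromℤR R (ℤ.- x) ≈ - fromℤR R x
  fromℤR-homo-neg (+ zero)  = sym -0#≈0#
  fromℤR-homo-neg (+ suc n) = ≈-refl
  fromℤR-homo-neg -[1+ n ]  = sym (-‿involutive _)

  fromℤR-homo-minus : ∀ x y → fromℤR R (x ℤ.- y) ≈ fromℤR R x - fromℤR R y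
  fromℤR-homo-minus x y = trans (fromℤR-homo-+ x (ℤ.- y)) (+-congˡ (fromℤR-homo-neg y))

  sumUpTo : ℕ → (ℕ → Carrier) → Carrier
  sumUpTo n f = sum {n} (λ i → f (toℕ i))

  sumR-map-upTo : ∀ n (f : ℕ → Carrier) → sumR R (map f (upTo n)) ≡ sumUpTo n f
  sumR-map-upTo n f = ≡.trans (≡.cong (sumR R) (Listₚ.map-upTo f n)) (sumR-applyUpTo n f)
    where
    sumR-applyUpTo : ∀ n (f : ℕ → Carrier) → sumR R (applyUpTo f n) ≡ sumUpTo n f
    sumR-applyUpTo zero    f = refl
    sumR-applyUpTo (suc n) f = ≡.cong (_+_ (f 0)) (sumR-applyUpTo n (f ∘ suc))

  sumR-map-tabulate : ∀ {A : Set} {n} (f : A → Carrier) (g : Fin n → A) → sumR R (map f (tabulate g)) ≡ sum (f ∘ g)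
  sumR-map-tabulate {n = zero}  f g = refl
  sumR-map-tabulate {n = suc n} f g = ≡.cong (_+_ (f (g zero))) (sumR-map-tabulate f (g ∘ suc))

  sumR-++ : ∀ xs ys → sumR R (xs ++ ys) ≈ sumR R xs + sumR R ys
  sumR-++ []       ys = sym (+-identityˡ _)
  sumR-++ (x ∷ xs) ys = trans (+-congˡ (sumR-++ xs ys)) (sym (+-assoc _ _ _))

  sumR-map-concatMap : ∀ {A B : Set} (T : B → Carrier) (F : A → List B) xs →
    sumR R (map T (concat (map F xs))) ≈ sumR R (map (λ x → sumR R (map T (F x))) xs)
  sumR-map-concatMap T F []       = ≈-refl
  sumR-map-concatMap T F (x ∷ xs) = begin
    sumR R (map T (F x ++ concat (map F xs)))            ≡⟨ ≡.cong (sumR R) (Listₚ.map-++ T (F x) _) ⟩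
    sumR R (map T (F x) ++ map T (concat (map F xs)))    ≈⟨ sumR-++ (map T (F x)) _ ⟩
    sumR R (map T (F x)) + sumR R (map T (concat (map F xs)))
      ≈⟨ +-congˡ (sumR-map-concatMap T F xs) ⟩
    sumR R (map T (F x)) + sumR R (map (λ x → sumR R (map T (F x))) xs) ∎

  sumR-map-cong : ∀ {A : Set} xs {f g : A → Carrier} → (∀ x → f x ≈ g x) → sumR R (map f xs) ≈ sumR R (map g xs)
  sumR-map-cong []       f≈g = ≈-refl
  sumR-map-cong (x ∷ xs) f≈g = +-cong (f≈g x) (sumR-map-cong xs f≈g)

  sumR-map-zero : ∀ {A : Set} xs {f : A → Carrier} → (∀ x → f x ≈ 0#) → sumR R (map f xs) ≈ 0#
  sumR-map-zero []       f≈0 = ≈-refl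
  sumR-map-zero (x ∷ xs) f≈0 = trans (+-cong (f≈0 x) (sumR-map-zero xs f≈0)) (+-identityˡ 0#)

  sumR-map-neg : ∀ {A : Set} xs (f : A → Carrier) → sumR R (map (λ x → - f x) xs) ≈ - sumR R (map f xs)
  sumR-map-neg []       f = sym -0#≈0#
  sumR-map-neg (x ∷ xs) f = trans (+-congˡ (sumR-map-neg xs f)) (-‿+-comm _ _)

  sumR-map-minus : ∀ {A : Set} xs (f g : A → Carrier) →
    sumR R (map (λ x → f x - g x) xs) ≈ sumR R (map f xs) - sumR R (map g xs)
  sumR-map-minus []       f g = sym (-‿inverseʳ 0#)
  sumR-map-minus (x ∷ xs) f g = begin
    (f x - g x) + sumR R (map (λ x → f x - g x) xs)
      ≈⟨ +-congˡ (sumR-map-minus xs f g) ⟩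
    (f x - g x) + (sumR R (map f xs) - sumR R (map g xs))
      ≈⟨ interchange _ _ _ _ ⟩
    (f x + sumR R (map f xs)) + (- g x - sumR R (map g xs))
      ≈⟨ +-congˡ (-‿+-comm _ _) ⟩
    (f x + sumR R (map f xs)) - (g x + sumR R (map g xs)) ∎

  sum-zero : ∀ {n} (f : Vector Carrier n) → (∀ i → f i ≈ 0#) → sum f ≈ 0#
  sum-zero {n} f f≈0 = trans (sum-cong-≋ {n} f≈0) (sum-replicate-zero n)

  -‿distrib-sum : ∀ {n} (f : Vector Carrier n) → - sum f ≈ sum (λ i → - f i)
  -‿distrib-sum {zero}  f = -0#≈0#
  -‿distrib-sum {suc n} f = trans (sym (-‿+-comm _ _)) (+-congˡ (-‿distrib-sum (f ∘ suc)))

  sumUpTo-snoc : ∀ n (f : ℕ → Carrier) → sumUpTo (suc n) f ≈ sumUpTo n f + f n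
  sumUpTo-snoc zero    f = trans (+-identityʳ (f 0)) (sym (+-identityˡ (f 0)))
  sumUpTo-snoc (suc n) f = begin
    f 0 + sumUpTo (suc n) (f ∘ suc)           ≈⟨ +-congˡ (sumUpTo-snoc n (f ∘ suc)) ⟩
    f 0 + (sumUpTo n (f ∘ suc) + f (suc n))   ≈⟨ +-assoc _ _ _ ⟨
    (f 0 + sumUpTo n (f ∘ suc)) + f (suc n)   ∎

  sumUpTo-cong-< : ∀ n {f g : ℕ → Carrier} → (∀ i → i < n → f i ≈ g i) → sumUpTo n f ≈ sumUpTo n g
  sumUpTo-cong-< n f≈g = sum-cong-≋ {n} (λ i → f≈g (toℕ i) (Finₚ.toℕ<n i))

  sumSquare-antisym≈0 : ∀ {n} (H : Fin n → Fin n → Carrier) → (∀ a → H a a ≈ 0#) → (∀ a b → H a b ≈ - H b a) →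
    sum (λ a → sum (H a)) ≈ 0#
  sumSquare-antisym≈0 {zero}  H diag anti = ≈-refl
  sumSquare-antisym≈0 {suc n} H diag anti = begin
    (H zero zero + row) + sum (λ a → H (suc a) zero + sum (λ b → H (suc a) (suc b)))
      ≈⟨ +-cong (+-congʳ (diag zero)) (∑-distrib-+ (λ a → H (suc a) zero) (λ a → sum (λ b → H (suc a) (suc b)))) ⟩
    (0# + row) + (col + sum (λ a → sum (λ b → H (suc a) (suc b))))
      ≈⟨ +-cong (+-identityˡ row) (+-congˡ (sumSquare-antisym≈0 (λ a b → H (suc a) (suc b)) (diag ∘ suc) (λ a b → anti (suc a) (suc b)))) ⟩
    row + (col + 0#)
      ≈⟨ +-congˡ (+-identityʳ col) ⟩
    row + col
      ≈⟨ ∑-distrib-+ (λ b → H zero (suc b)) (λ b → H (suc b) zero) ⟨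
    sum (λ b → H zero (suc b) + H (suc b) zero)
      ≈⟨ sum-zero _ (λ b → trans (+-congʳ (anti zero (suc b))) (-‿inverseˡ _)) ⟩
    0# ∎
    where
    row = sum (λ b → H zero (suc b))
    col = sum (λ a → H (suc a) zero)

  -- The index set is the triangle i + j ≤ n - 2.
  sumTriangle-antisym≈0 : ∀ n (W : ℕ → ℕ → Carrier) → (∀ i → W i i ≈ 0#) → (∀ i j → W i j ≈ - W j i) →
    sumUpTo n (λ i → sumUpTo (n ∸ suc i) (W i)) ≈ 0#
  sumTriangle-antisym≈0 zero          W diag anti = ≈-refl
  sumTriangle-antisym≈0 (suc zero)    W diag anti = +-identityˡ 0#
  sumTriangle-antisym≈0 (suc (suc m)) W diag anti = begin
    (W 0 0 + row) + sumUpTo (suc m) (λ i → sumUpTo (m ∸ i) (W (suc i)))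
      ≈⟨ +-cong (+-congʳ (diag 0)) lower≈col ⟩
    (0# + row) + col
      ≈⟨ +-congʳ (+-identityˡ row) ⟩
    row + col
      ≈⟨ ∑-distrib-+ {m} (λ j → W 0 (suc (toℕ j))) (λ j → W (suc (toℕ j)) 0) ⟨
    sumUpTo m (λ j → W 0 (suc j) + W (suc j) 0)
      ≈⟨ sum-zero {m} _ (λ j → trans (+-congʳ (anti 0 (suc (toℕ j)))) (-‿inverseˡ _)) ⟩
    0# ∎
    where
    row = sumUpTo m (λ j → W 0 (suc j))
    col = sumUpTo m (λ i → W (suc i) 0)
    inner = sumUpTo m (λ i → sumUpTo (m ∸ suc i) (λ j → W (suc i) (suc j)))
    lower≈col : sumUpTo (suc m) (λ i → sumUpTo (m ∸ i) (W (suc i))) ≈ col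
    lower≈col = begin
      sumUpTo (suc m) (λ i → sumUpTo (m ∸ i) (W (suc i)))
        ≈⟨ sumUpTo-snoc m (λ i → sumUpTo (m ∸ i) (W (suc i))) ⟩
      sumUpTo m (λ i → sumUpTo (m ∸ i) (W (suc i))) + sumUpTo (m ∸ m) (W (suc m))
        ≈⟨ +-cong (sumUpTo-cong-< m (λ i i<m → reflexive (≡.cong (λ t → sumUpTo t (W (suc i))) (m∸n≡1+m∸[1+n] i<m))))
                  (reflexive (≡.cong (λ t → sumUpTo t (W (suc m))) (ℕₚ.n∸n≡0 m))) ⟩
      sumUpTo m (λ i → W (suc i) 0 + sumUpTo (m ∸ suc i) (λ j → W (suc i) (suc j))) + 0#
        ≈⟨ +-identityʳ _ ⟩
      sumUpTo m (λ i → W (suc i) 0 + sumUpTo (m ∸ suc i) (λ j → W (suc i) (suc j)))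
        ≈⟨ ∑-distrib-+ {m} (λ i → W (suc (toℕ i)) 0) (λ i → sumUpTo (m ∸ suc (toℕ i)) (λ j → W (suc (toℕ i)) (suc j))) ⟩
      col + inner
        ≈⟨ +-congˡ (sumTriangle-antisym≈0 m (λ i j → W (suc i) (suc j)) (diag ∘ suc) (λ i j → anti (suc i) (suc j))) ⟩
      col + 0#
        ≈⟨ +-identityʳ col ⟩
      col ∎

  -- Sums over compositions

  sumComps : ∀ {M} → ((Fin M → ℕ) → Carrier) → ℕ → Carrier
  sumComps {M} T N = sumR R (map T (comps N M))

  sumComps-suc : ∀ {M} (T : (Fin (suc M) → ℕ) → Carrier) N →
    sumComps T N ≈ sumUpTo (suc N) (λ i → sumComps (T ∘ (i ∷ᵥ_)) (N ∸ i))
  sumComps-suc {M} T N = begin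
    sumR R (map T (comps N (suc M)))
      ≡⟨ ≡.cong (sumR R ∘ map T) (comps-suc N M) ⟩
    sumR R (map T (concat (map F (upTo (suc N)))))
      ≈⟨ sumR-map-concatMap T F (upTo (suc N)) ⟩
    sumR R (map (λ i → sumR R (map T (F i))) (upTo (suc N)))
      ≡⟨ ≡.cong (sumR R) (Listₚ.map-cong (λ i → ≡.cong (sumR R) (≡.sym (Listₚ.map-∘ (comps (N ∸ i) M)))) (upTo (suc N))) ⟩
    sumR R (map (λ i → sumComps (T ∘ (i ∷ᵥ_)) (N ∸ i)) (upTo (suc N)))
      ≡⟨ sumR-map-upTo (suc N) _ ⟩
    sumUpTo (suc N) (λ i → sumComps (T ∘ (i ∷ᵥ_)) (N ∸ i)) ∎
    where
    F : ℕ → List (Fin (suc M) → ℕ)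
    F i = map (i ∷ᵥ_) (comps (N ∸ i) M)

  sumComps-dotAlternating≈0 : ∀ {M} {k₀ k : Fin M} (T : (Fin M → ℕ) → Carrier) → Adjacent k₀ k →
    (∀ E → E k ≡ 0 → T E ≈ 0#) → (∀ E → E k ≡ suc (E k₀) → T E ≈ 0#) →
    (∀ E E′ → DotTransposed k₀ k E E′ → T E′ ≈ - T E) → ∀ N → sumComps T N ≈ 0#
  sumComps-dotAlternating≈0 {suc (suc M)} T here low fixed alt N = begin
    sumComps T N
      ≈⟨ sumComps-suc T N ⟩
    sumUpTo (suc N) (λ i → sumComps (T ∘ (i ∷ᵥ_)) (N ∸ i))
      ≈⟨ sum-cong-≋ {suc N} (λ i → sumComps-suc (T ∘ (toℕ i ∷ᵥ_)) (N ∸ toℕ i)) ⟩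
    sumUpTo (suc N) (λ i → Q i 0 + sumUpTo (N ∸ i) (W i))
      ≈⟨ sum-cong-≋ {suc N} (λ i → trans (+-congʳ (Q-zero (toℕ i))) (+-identityˡ (sumUpTo (N ∸ toℕ i) (W (toℕ i))))) ⟩
    sumUpTo (suc N) (λ i → sumUpTo (suc N ∸ suc i) (W i))
      ≈⟨ sumTriangle-antisym≈0 (suc N) W W-diag W-anti ⟩
    0# ∎
    where
    Q : ℕ → ℕ → Carrier
    Q i j = sumComps (λ E → T (i ∷ᵥ j ∷ᵥ E)) (N ∸ i ∸ j)
    W : ℕ → ℕ → Carrier
    W i j = Q i (suc j)
    Q-zero : ∀ i → Q i 0 ≈ 0#
    Q-zero i = sumR-map-zero (comps (N ∸ i ∸ 0) M) (λ E → low _ refl)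
    W-diag : ∀ i → W i i ≈ 0#
    W-diag i = sumR-map-zero (comps (N ∸ i ∸ suc i) M) (λ E → fixed _ refl)
    W-anti : ∀ i j → W i j ≈ - W j i
    W-anti i j = begin
      sumComps (λ E → T (i ∷ᵥ suc j ∷ᵥ E)) (N ∸ i ∸ suc j)
        ≈⟨ sumR-map-cong (comps (N ∸ i ∸ suc j) M) (λ E → alt _ _ (swapped E)) ⟩
      sumR R (map (λ E → - T (j ∷ᵥ suc i ∷ᵥ E)) (comps (N ∸ i ∸ suc j) M))
        ≈⟨ sumR-map-neg (comps (N ∸ i ∸ suc j) M) _ ⟩
      - sumComps (λ E → T (j ∷ᵥ suc i ∷ᵥ E)) (N ∸ i ∸ suc j)
        ≡⟨ ≡.cong (λ t → - sumComps (λ E → T (j ∷ᵥ suc i ∷ᵥ E)) t) ([m∸n]∸[1+o]≡[m∸o]∸[1+n] N i j) ⟩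
      - W j i ∎
      where
      swapped : ∀ E → DotTransposed zero (suc zero) (j ∷ᵥ suc i ∷ᵥ E) (i ∷ᵥ suc j ∷ᵥ E)
      swapped E = refl , refl , λ
        { zero          0≢0 _   → ⊥-elim (0≢0 refl)
        ; (suc zero)    _   1≢1 → ⊥-elim (1≢1 refl)
        ; (suc (suc r)) _   _   → refl
        }
  sumComps-dotAlternating≈0 {suc M} T (there adj) low fixed alt N = begin
    sumComps T N
      ≈⟨ sumComps-suc T N ⟩
    sumUpTo (suc N) (λ i → sumComps (T ∘ (i ∷ᵥ_)) (N ∸ i))
      ≈⟨ sum-zero {suc N} _ (λ i → sumComps-dotAlternating≈0 (T ∘ (toℕ i ∷ᵥ_)) adj
           (λ E → low _) (λ E → fixed _) (λ E E′ d → alt _ _ (dotTransposed-cons (toℕ i) d)) (N ∸ toℕ i)) ⟩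
    0# ∎

  -- Determinants

  signR-cong : ∀ m {x y} → x ≈ y → signR R m x ≈ signR R m y
  signR-cong zero    x≈y = x≈y
  signR-cong (suc m) x≈y = -‿cong (signR-cong m x≈y)

  signR-neg : ∀ m x → signR R m (- x) ≈ - signR R m x
  signR-neg zero    x = ≈-refl
  signR-neg (suc m) x = -‿cong (signR-neg m x)

  signR-0# : ∀ m → signR R m 0# ≈ 0#
  signR-0# zero    = ≈-refl
  signR-0# (suc m) = trans (-‿cong (signR-0# m)) -0#≈0#

  signR-*ʳ : ∀ m x y → signR R m (x * y) ≈ x * signR R m y
  signR-*ʳ zero    x y = ≈-refl
  signR-*ʳ (suc m) x y = trans (-‿cong (signR-*ʳ m x y)) (-‿distribʳ-* x _)

  signR-signR : ∀ m n x → signR R m (signR R n x) ≡ signR R (m ℕ.+ n) x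
  signR-signR zero    n x = refl
  signR-signR (suc m) n x = ≡.cong -_ (signR-signR m n x)

  signR-sum : ∀ m {n} (f : Vector Carrier n) → signR R m (sum f) ≈ sum (λ i → signR R m (f i))
  signR-sum m {zero}  f = signR-0# m
  signR-sum m {suc n} f = trans (signR-distrib m (f zero) (sum (f ∘ suc))) (+-congˡ (signR-sum m (f ∘ suc)))
    where
    signR-distrib : ∀ m x y → signR R m (x + y) ≈ signR R m x + signR R m y
    signR-distrib zero    x y = ≈-refl
    signR-distrib (suc m) x y = trans (-‿cong (signR-distrib m x y)) (sym (-‿+-comm _ _))

  Matrix : ℕ → Set c
  Matrix n = Fin n → Fin n → Carrier

  minor : ∀ {n} → Matrix (suc n) → Fin (suc n) → Matrix n
  minor A j r c = A (suc r) (punchIn j c)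

  det-expand : ∀ n (A : Matrix (suc n)) → det R (suc n) A ≡ sum (λ j → signR R (toℕ j) (A zero j * det R n (minor A j)))
  det-expand n A = sumR-map-tabulate {n = suc n} (λ j → signR R (toℕ j) (A zero j * det R n (minor A j))) (λ j → j)

  det-cong : ∀ n {A B : Matrix n} → (∀ r → A r ≋ B r) → det R n A ≈ det R n B
  det-cong zero    A≋B = ≈-refl
  det-cong (suc n) {A} {B} A≋B = begin
    det R (suc n) A
      ≡⟨ det-expand n A ⟩
    sum (λ j → signR R (toℕ j) (A zero j * det R n (minor A j)))
      ≈⟨ sum-cong-≋ (λ j → signR-cong (toℕ j) (*-cong (A≋B zero j) (det-cong n (λ r c → A≋B (suc r) (punchIn j c))))) ⟩
    sum (λ j → signR R (toℕ j) (B zero j * det R n (minor B j)))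
      ≡⟨ det-expand n B ⟨
    det R (suc n) B ∎

  -- The term of the Laplace expansion of det A along its first two rows that uses column a in row 0 and column b in row 1.
  twoRowTerm : ∀ {n} → Matrix (suc (suc n)) → Fin (suc (suc n)) → Fin (suc (suc n)) → Carrier
  twoRowTerm A a b with a ≟ b
  ... | yes _   = 0#
  ... | no a≢b = signR R (toℕ a ℕ.+ toℕ (punchOut a≢b))
                   ((A zero a * A (suc zero) b) * det R _ (minor (minor A a) (punchOut a≢b)))

  twoRowTerm-diagonal : ∀ {n} (A : Matrix (suc (suc n))) a → twoRowTerm A a a ≈ 0#
  twoRowTerm-diagonal A a with a ≟ a
  ... | yes _   = ≈-refl
  ... | no a≢a = ⊥-elim (a≢a refl)

  twoRowTerm-punchIn : ∀ {n} (A : Matrix (suc (suc n))) a j → twoRowTerm A a (punchIn a j) ≈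
    signR R (toℕ a ℕ.+ toℕ j) ((A zero a * A (suc zero) (punchIn a j)) * det R n (minor (minor A a) j))
  twoRowTerm-punchIn {n} A a j with a ≟ punchIn a j
  ... | yes a≡ = ⊥-elim (Finₚ.punchInᵢ≢i a j (≡.sym a≡))
  ... | no a≢  = reflexive (≡.cong term (≡.trans (Finₚ.punchOut-cong a refl) (Finₚ.punchOut-punchIn a)))
    where
    term : Fin (suc n) → Carrier
    term j′ = signR R (toℕ a ℕ.+ toℕ j′) ((A zero a * A (suc zero) (punchIn a j)) * det R n (minor (minor A a) j′))

  det-expand₂ : ∀ n (A : Matrix (suc (suc n))) → det R (suc (suc n)) A ≈ sum (λ a → sum (twoRowTerm A a))
  det-expand₂ n A = trans (reflexive (det-expand (suc n) A)) (sum-cong-≋ row)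
    where
    row : ∀ a → signR R (toℕ a) (A zero a * det R (suc n) (minor A a)) ≈ sum (twoRowTerm A a)
    row a = begin
      signR R (toℕ a) (A zero a * det R (suc n) (minor A a))
        ≡⟨ ≡.cong (λ d → signR R (toℕ a) (A zero a * d)) (det-expand n (minor A a)) ⟩
      signR R (toℕ a) (A zero a * sum g)
        ≈⟨ signR-cong (toℕ a) (*-distribˡ-sum (A zero a) g) ⟩
      signR R (toℕ a) (sum (λ j → A zero a * g j))
        ≈⟨ signR-sum (toℕ a) (λ j → A zero a * g j) ⟩
      sum (λ j → signR R (toℕ a) (A zero a * g j))
        ≈⟨ sum-cong-≋ (λ j → trans (combine j) (sym (twoRowTerm-punchIn A a j))) ⟩
      sum (λ j → twoRowTerm A a (punchIn a j))
        ≈⟨ +-identityˡ _ ⟨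
      0# + sum (λ j → twoRowTerm A a (punchIn a j))
        ≈⟨ +-congʳ (twoRowTerm-diagonal A a) ⟨
      twoRowTerm A a a + sum (λ j → twoRowTerm A a (punchIn a j))
        ≈⟨ sum-remove {i = a} (twoRowTerm A a) ⟨
      sum (twoRowTerm A a) ∎
      where
      d : Fin (suc n) → Carrier
      d j = det R n (minor (minor A a) j)
      g : Fin (suc n) → Carrier
      g j = signR R (toℕ j) (A (suc zero) (punchIn a j) * d j)
      combine : ∀ j → signR R (toℕ a) (A zero a * g j)
                    ≈ signR R (toℕ a ℕ.+ toℕ j) ((A zero a * A (suc zero) (punchIn a j)) * d j)
      combine j = begin
        signR R (toℕ a) (A zero a * g j)                                      ≈⟨ signR-cong (toℕ a) (signR-*ʳ (toℕ j) _ _) ⟨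
        signR R (toℕ a) (signR R (toℕ j) (A zero a * (A (suc zero) (punchIn a j) * d j)))  ≡⟨ signR-signR (toℕ a) (toℕ j) _ ⟩
        signR R (toℕ a ℕ.+ toℕ j) (A zero a * (A (suc zero) (punchIn a j) * d j))          ≈⟨ signR-cong (toℕ a ℕ.+ toℕ j) (*-assoc _ _ _) ⟨
        signR R (toℕ a ℕ.+ toℕ j) ((A zero a * A (suc zero) (punchIn a j)) * d j)          ∎

  twoRowTerm-swapRows : ∀ {n} {A B : Matrix (suc (suc n))} →
    B zero ≋ A (suc zero) → B (suc zero) ≋ A zero → (∀ r → B (suc (suc r)) ≋ A (suc (suc r))) →
    ∀ a b → twoRowTerm B a b ≈ - twoRowTerm A b a
  twoRowTerm-swapRows {n} {A} {B} B0≋A1 B1≋A0 rest a b with a ≟ b | b ≟ a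
  ... | yes _    | yes _    = sym -0#≈0#
  ... | yes a≡b | no b≢a  = ⊥-elim (b≢a (≡.sym a≡b))
  ... | no a≢b  | yes b≡a = ⊥-elim (a≢b (≡.sym b≡a))
  ... | no a≢b  | no b≢a  = signs-differ (punchOut-parity a b a≢b b≢a)
    where
    m  = toℕ a ℕ.+ toℕ (punchOut a≢b)
    m′ = toℕ b ℕ.+ toℕ (punchOut b≢a)
    X = (A zero b * A (suc zero) a) * det R n (minor (minor A b) (punchOut b≢a))
    Y = (B zero a * B (suc zero) b) * det R n (minor (minor B a) (punchOut a≢b))
    Y≈X : Y ≈ X
    Y≈X = *-cong (trans (*-cong (B0≋A1 a) (B1≋A0 b)) (*-comm _ _))
                 (det-cong n (λ r c → trans (rest r _) (reflexive (≡.cong (A (suc (suc r))) (punchIn-punchOut-comm a b a≢b b≢a c)))))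
    signs-differ : m′ ≡ suc m ⊎ m ≡ suc m′ → signR R m Y ≈ - signR R m′ X
    signs-differ (inj₁ m′≡1+m) = begin
      signR R m Y        ≈⟨ signR-cong m Y≈X ⟩
      signR R m X        ≈⟨ -‿involutive _ ⟨
      - - signR R m X    ≡⟨ ≡.cong (λ t → - signR R t X) m′≡1+m ⟨
      - signR R m′ X     ∎
    signs-differ (inj₂ m≡1+m′) = begin
      signR R m Y        ≡⟨ ≡.cong (λ t → signR R t Y) m≡1+m′ ⟩
      - signR R m′ Y     ≈⟨ -‿cong (signR-cong m′ Y≈X) ⟩
      - signR R m′ X     ∎

  det-transposeRows : ∀ {n} {k₀ k : Fin n} {A B : Matrix n} →
    Adjacent k₀ k → Transposed _≋_ k₀ k A B → det R n B ≈ - det R n A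
  det-transposeRows {suc (suc n)} {A = A} {B} here (B0≋A1 , B1≋A0 , rest) = begin
    det R (suc (suc n)) B
      ≈⟨ det-expand₂ n B ⟩
    sum (λ a → sum (twoRowTerm B a))
      ≈⟨ sum-cong-≋ (λ a → sum-cong-≋ (twoRowTerm-swapRows {A = A} {B} B0≋A1 B1≋A0 (λ r → rest (suc (suc r)) (λ ()) (λ ())) a)) ⟩
    sum (λ a → sum (λ b → - twoRowTerm A b a))
      ≈⟨ sum-cong-≋ (λ a → -‿distrib-sum (λ b → twoRowTerm A b a)) ⟨
    sum (λ a → - sum (λ b → twoRowTerm A b a))
      ≈⟨ -‿distrib-sum (λ a → sum (λ b → twoRowTerm A b a)) ⟨
    - sum (λ a → sum (λ b → twoRowTerm A b a))
      ≈⟨ -‿cong (∑-comm (λ a b → twoRowTerm A b a)) ⟩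
    - sum (λ b → sum (twoRowTerm A b))
      ≈⟨ -‿cong (det-expand₂ n A) ⟨
    - det R (suc (suc n)) A ∎
  det-transposeRows {suc n} {k₀ = suc k₀} {suc k} {A} {B} (there adj) t@(_ , _ , rest) = begin
    det R (suc n) B
      ≡⟨ det-expand n B ⟩
    sum (λ j → signR R (toℕ j) (B zero j * det R n (minor B j)))
      ≈⟨ sum-cong-≋ (λ j → signR-cong (toℕ j) (*-cong (rest zero (λ ()) (λ ()) j) (det-transposeRows adj (minors j)))) ⟩
    sum (λ j → signR R (toℕ j) (A zero j * - det R n (minor A j)))
      ≈⟨ sum-cong-≋ (λ j → trans (signR-cong (toℕ j) (sym (-‿distribʳ-* (A zero j) (det R n (minor A j))))) (signR-neg (toℕ j) _)) ⟩
    sum (λ j → - signR R (toℕ j) (A zero j * det R n (minor A j)))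
      ≈⟨ -‿distrib-sum (λ j → signR R (toℕ j) (A zero j * det R n (minor A j))) ⟨
    - sum (λ j → signR R (toℕ j) (A zero j * det R n (minor A j)))
      ≡⟨ ≡.cong -_ (det-expand n A) ⟨
    - det R (suc n) A ∎
    where
    minors : ∀ j → Transposed _≋_ k₀ k (minor A j) (minor B j)
    minors j with transposed-suc {_∼_ = _≋_} t
    ... | e₀ , e , rest′ = (λ c → e₀ (punchIn j c)) , (λ c → e (punchIn j c)) , (λ i i≢k₀ i≢k c → rest′ i i≢k₀ i≢k (punchIn j c))

  det-equalRows : ∀ {n} {k₀ k : Fin n} {A : Matrix n} → Adjacent k₀ k → A k₀ ≋ A k → det R n A ≈ 0#
  det-equalRows {suc (suc n)} {A = A} here A0≋A1 = trans (det-expand₂ n A)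
    (sumSquare-antisym≈0 (twoRowTerm A) (twoRowTerm-diagonal A)
      (twoRowTerm-swapRows {A = A} {A} A0≋A1 (λ c → sym (A0≋A1 c)) (λ r c → ≈-refl)))
  det-equalRows {suc n} {A = A} (there adj) Ak₀≋Ak = trans (reflexive (det-expand n A))
    (sum-zero _ (λ j → trans (signR-cong (toℕ j) (trans (*-congˡ (det-equalRows adj (λ c → Ak₀≋Ak (punchIn j c)))) (zeroʳ (A zero j))))
                             (signR-0# (toℕ j))))

  -- Schur functions

  module _ (h : ℕ → Carrier) where

    schurMatrix : ∀ {M} → (Fin M → ℕ) → Matrix M
    schurMatrix E i j = hZ R h ((+ E i ℤ.+ + toℕ j) ℤ.- + toℕ i)

    schurMatrix-shift : ∀ {M} {E E′ : Fin M → ℕ} {i i′} →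
      E′ i′ ≡ suc (E i) → toℕ i′ ≡ suc (toℕ i) → schurMatrix E i ≋ schurMatrix E′ i′
    schurMatrix-shift {E = E} {i = i} E′i′≡1+Ei i′≡1+i c rewrite E′i′≡1+Ei | i′≡1+i =
      reflexive (≡.cong (hZ R h) (≡.sym ([1+m]-[1+n]≡m-n (E i ℕ.+ toℕ c) (toℕ i))))

    schur-dotTransposed : ∀ {M} {k₀ k : Fin M} {E E′} → Adjacent k₀ k → DotTransposed k₀ k E E′ →
      schur R h (λ i → + E′ i) ≈ - schur R h (λ i → + E i)
    schur-dotTransposed {E = E} {E′} adj (Ek≡1+E′k₀ , E′k≡1+Ek₀ , rest) = det-transposeRows adj
      ( schurMatrix-shift {E = E′} {E} Ek≡1+E′k₀ k≡1+k₀
      , (λ c → sym (schurMatrix-shift {E = E} {E′} E′k≡1+Ek₀ k≡1+k₀ c))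
      , λ i i≢k₀ i≢k c → reflexive (≡.cong (λ e → hZ R h ((+ e ℤ.+ + toℕ c) ℤ.- + toℕ i)) (rest i i≢k₀ i≢k)))
      where k≡1+k₀ = adjacent⇒toℕ adj

    schur-equalAdjacent : ∀ {M} {k₀ k : Fin M} {E} → Adjacent k₀ k → E k ≡ suc (E k₀) →
      schur R h (λ i → + E i) ≈ 0#
    schur-equalAdjacent {E = E} adj Ek≡1+Ek₀ =
      det-equalRows adj (schurMatrix-shift {E = E} {E} Ek≡1+Ek₀ (adjacent⇒toℕ adj))

    Sdeg-split : ∀ {M} N (μ : Fin M → ℕ) J k →
      Sdeg R h N μ J ≈ Sdeg R h N μ (subε J k) - Sdeg R h N (addε μ k) (subε J k)
    Sdeg-split {M} N μ J k = trans (sumR-map-cong (comps N M) split) (sumR-map-minus (comps N M) _ _)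
      where
      s : (Fin M → ℕ) → Carrier
      s E = schur R h (λ i → + E i)
      split : ∀ E → fromℤR R (coeff μ J E) * s E ≈
        fromℤR R (coeff μ (subε J k) E) * s E - fromℤR R (coeff (addε μ k) (subε J k) E) * s E
      split E = begin
        fromℤR R (coeff μ J E) * s E
          ≡⟨ ≡.cong (λ x → fromℤR R x * s E) (coeff-split μ J k E) ⟩
        fromℤR R (coeff μ (subε J k) E ℤ.- coeff (addε μ k) (subε J k) E) * s E
          ≈⟨ *-congʳ (fromℤR-homo-minus (coeff μ (subε J k) E) (coeff (addε μ k) (subε J k) E)) ⟩
        (fromℤR R (coeff μ (subε J k) E) - fromℤR R (coeff (addε μ k) (subε J k) E)) * s E
          ≈⟨ [y-z]x≈yx-zx _ _ _ ⟩
        fromℤR R (coeff μ (subε J k) E) * s E - fromℤR R (coeff (addε μ k) (subε J k) E) * s E ∎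

    Sdeg-vanishes : ∀ {M} {μ : Fin M → ℕ} {J : Fin M → ℤ} {k₀ k} → Adjacent k₀ k →
      J k₀ ≡ J k → μ k ≡ suc (μ k₀) → ∀ N → Sdeg R h N μ J ≈ 0#
    Sdeg-vanishes {μ = μ} {J} {k₀} {k} adj Jk₀≡Jk μk≡1+μk₀ =
      sumComps-dotAlternating≈0 term adj below fixed alternating
      where
      term : (Fin _ → ℕ) → Carrier
      term E = fromℤR R (coeff μ J E) * schur R h (λ i → + E i)
      below : ∀ E → E k ≡ 0 → term E ≈ 0#
      below E Ek≡0 = trans (*-congʳ (reflexive (≡.cong (fromℤR R) (coeff-below μ J E k Ek<μk)))) (zeroˡ _)
        where Ek<μk = ≡.subst₂ _<_ (≡.sym Ek≡0) (≡.sym μk≡1+μk₀) (s≤s ℕ.z≤n)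
      fixed : ∀ E → E k ≡ suc (E k₀) → term E ≈ 0#
      fixed E Ek≡1+Ek₀ = trans (*-congˡ (schur-equalAdjacent {E = E} adj Ek≡1+Ek₀)) (zeroʳ _)
      alternating : ∀ E E′ → DotTransposed k₀ k E E′ → term E′ ≈ - term E
      alternating E E′ d = begin
        fromℤR R (coeff μ J E′) * schur R h (λ i → + E′ i)
          ≈⟨ *-cong (reflexive (≡.cong (fromℤR R) (≡.sym (coeff-dotTransposed adj Jk₀≡Jk μk≡1+μk₀ d))))
                    (schur-dotTransposed {E = E} {E′} adj d) ⟩
        fromℤR R (coeff μ J E) * - schur R h (λ i → + E i)
          ≈⟨ -‿distribʳ-* _ _ ⟨
        - term E ∎

lemma4p5 : ∀ {c ℓ} (R : CommutativeRing c ℓ) (h : ℕ → CommutativeRing.Carrier R) →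
    CommutativeRing._≈_ R (h 0) (CommutativeRing.1# R) →
    (M p : ℕ) → p ≤ M →
    (λ' : Fin M → ℕ) → IsPartitionOfLength p λ' →
    (I : Fin M → ℤ) → WeaklyIncreasingℤ I →
    (k k₀ : Fin M) → toℕ k ≡ suc (toℕ k₀) → I k ≡ I k₀ ℤ.+ + 1 →
    (λ' k₀ ≡ λ' k →
       ∀ (N : ℕ) → CommutativeRing._≈_ R (Sdeg R h N λ' I) (Sdeg R h N λ' (subε I k)))
    × (λ' k < λ' k₀ →
       WeaklyDecreasing (addε λ' k)
       × (∀ (N : ℕ) → CommutativeRing._≈_ R (Sdeg R h N λ' I)
            (CommutativeRing._-_ R (Sdeg R h N λ' (subε I k)) (Sdeg R h N (addε λ' k) (subε I k)))))
lemma4p5 R h _ M p _ λ' (decreasing , _) I _ k k₀ k≡1+k₀ Ik≡Ik₀+1 =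
    (λ λ'k₀≡λ'k N → begin
      Sdeg R h N λ' I
        ≈⟨ Sdeg-split R h N λ' I k ⟩
      Sdeg R h N λ' (subε I k) - Sdeg R h N (addε λ' k) (subε I k)
        ≈⟨ +-congˡ (-‿cong (Sdeg-vanishes R h adj Jk₀≡Jk (μk≡1+μk₀ λ'k₀≡λ'k) N)) ⟩
      Sdeg R h N λ' (subε I k) - 0#
        ≈⟨ trans (+-congˡ -0#≈0#) (+-identityʳ _) ⟩
      Sdeg R h N λ' (subε I k) ∎)
  , (λ λ'k<λ'k₀ → addε-weaklyDecreasing decreasing k≡1+k₀ λ'k<λ'k₀ , λ N → Sdeg-split R h N λ' I k)
  where
  open CommutativeRing R using (_-_; 0#; +-congˡ; -‿cong; trans; +-identityʳ; setoid; ring)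
  open import Algebra.Properties.Ring ring using (-0#≈0#)
  open import Relation.Binary.Reasoning.Setoid setoid
  adj : Adjacent k₀ k
  adj = toℕ-adjacent k≡1+k₀
  Jk₀≡Jk : subε I k k₀ ≡ subε I k k
  Jk₀≡Jk = ≡.trans (subε-minimal I (adjacent⇒≢ adj))
    (≡.sym (≡.trans (subε-updates I k) (≡.trans (≡.cong (ℤ._- + 1) Ik≡Ik₀+1) ([x+1]-1≡x (I k₀)))))
    where
    [x+1]-1≡x : ∀ x → (x ℤ.+ + 1) ℤ.- + 1 ≡ x
    [x+1]-1≡x = solve-∀
  μk≡1+μk₀ : λ' k₀ ≡ λ' k → addε λ' k k ≡ suc (addε λ' k k₀)
  μk≡1+μk₀ λ'k₀≡λ'k =
    ≡.trans (addε-updates λ' k) (≡.cong suc (≡.sym (≡.trans (addε-minimal λ' (adjacent⇒≢ adj)) λ'k₀≡λ'k)))
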